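{- $\chi^2(\mathbb{Z})\ge 4$.
   Context: Let $S\subseteq\mathbb{R}$ and $k,m\in\mathbb{N}$, and let $D=(d_{ij})$ be a $k\times m$ array of positive real numbers. $S$ is called $D$-colorable if there is a coloring $T:S\to\{C_1,\dots,C_m\}$ such that for all $1\le i\le k$ and $1\le j\le m$, no two points $x,y\in S$ with $|x-y|=d_{ij}$ are both colored $C_j$. The $k^{\rm th}$ upper chromatic number $\chi^k(S)$ is the smallest integer $m$ such that $S$ is $D$-colorable for every $k\times m$ array $D$ of positive reals; if no such integer exists, $\chi^k(S)=\infty$. -}

module Defs where

open import Data.Nat using (ℕ; _<_)
open import Data.Integer using (ℤ; _-_; ∣_∣)
open import Data.Fin using (Fin)
open import Data.Product using (Σ)
open import Data.Empty using (⊥)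
open import Relation.Binary.PropositionalEquality using (_≡_)

-- A k×m array of distances.  Since S = ℤ, only distances |x-y| ∈ ℕ can
-- ever be realised, so entries are taken to be natural numbers (positivity
-- is required separately).
Array : ℕ → ℕ → Set
Array k m = Fin k → Fin m → ℕ

Positive : ∀ {k m} → Array k m → Set
Positive {k} {m} D = (i : Fin k) (j : Fin m) → 0 < D i j

ℤ-Colorable : ∀ {k m} → Array k m → Set
ℤ-Colorable {k} {m} D =
  Σ (ℤ → Fin m) λ T →
    (i : Fin k) (j : Fin m) (x y : ℤ) →
      ∣ x - y ∣ ≡ D i j → T x ≡ j → T y ≡ j → ⊥

-- m has the defining property of χ^k(ℤ): ℤ is D-colorable for every
-- k×m array D of positive distances.
ChiProperty : ℕ → ℕ → Set
ChiProperty k m = (D : Array k m) → Positive D → ℤ-Colorable D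

{-# OPTIONS --safe #-}
-- Colors with more room never hurt, so it suffices to exhibit a 2×3 array
-- that ℤ cannot realize: two colors forbidding distances 1 and 2, and a
-- third forbidding 2 and 3.  Three consecutive integers have pairwise
-- distances 1, 1, 2, so each of the first two colors occurs at most once
-- among them and the third color occurs in every such window.  If n has the
-- third color, the window {n+1, n+2, n+3} forces it onto n+1, as n+2 and n+3
-- lie at distances 2 and 3 from n; repeating, n+2 has it too, at distance 2
-- from n.
module Submission where

open import Defs
open import Data.Nat using (ℕ; _+_; _∸_; _≤_; z<s)
open import Data.Nat.Properties using (≤-pred; ≮⇒≥; m≤n+m; m+n∸n≡m)
open import Data.Integer using (+_; _-_; _⊖_; ∣_∣)
open import Data.Integer.Properties using ([+m]-[+n]≡m⊖n; ⊖-≥)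
open import Data.Fin using (Fin; zero; suc; inject≤)
open import Data.Fin.Properties using (inject≤-injective)
open import Data.Product using (_,_; proj₁; proj₂)
open import Data.Sum using (_⊎_; inj₁; inj₂)
open import Data.Empty using (⊥; ⊥-elim)
open import Relation.Nullary using (¬_)
open import Relation.Binary.PropositionalEquality using (_≡_; refl; cong; module ≡-Reasoning)

restrictColors : ∀ {k m n} → m ≤ n → Array k n → Array k m
restrictColors m≤n D i c = D i (inject≤ c m≤n)

restrictColors-positive : ∀ {k m n} (m≤n : m ≤ n) {D : Array k n} →
                          Positive D → Positive (restrictColors m≤n D)
restrictColors-positive m≤n D-pos i c = D-pos i (inject≤ c m≤n)

restrictColors-colorable⇒colorable : ∀ {k m n} (m≤n : m ≤ n) {D : Array k n} →
                                     ℤ-Colorable (restrictColors m≤n D) → ℤ-Colorable D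
restrictColors-colorable⇒colorable m≤n (T , proper) =
  (λ x → inject≤ (T x) m≤n) ,
  λ { i _ x y dist refl Ty≡Tx → proper i (T x) x y dist refl (inject≤-injective m≤n m≤n (T y) (T x) Ty≡Tx) }

ChiProperty-mono : ∀ {k m n} → m ≤ n → ChiProperty k m → ChiProperty k n
ChiProperty-mono m≤n χ D D-pos =
  restrictColors-colorable⇒colorable m≤n (χ (restrictColors m≤n D) (restrictColors-positive m≤n D-pos))

∣+[d+a]-+a∣≡d : ∀ d a → ∣ + (d + a) - + a ∣ ≡ d
∣+[d+a]-+a∣≡d d a = begin
  ∣ + (d + a) - + a ∣ ≡⟨ cong ∣_∣ ([+m]-[+n]≡m⊖n (d + a) a) ⟩
  ∣ (d + a) ⊖ a ∣     ≡⟨ cong ∣_∣ (⊖-≥ (m≤n+m a d)) ⟩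
  d + a ∸ a           ≡⟨ m+n∸n≡m d a ⟩
  d                   ∎
  where open ≡-Reasoning

pattern A = zero
pattern B = suc zero
pattern C = suc (suc zero)

obstruction : Array 2 3
obstruction zero       A = 1
obstruction zero       B = 1
obstruction zero       C = 2
obstruction (suc zero) A = 2
obstruction (suc zero) B = 2
obstruction (suc zero) C = 3

obstruction-positive : Positive obstruction
obstruction-positive zero       A = z<s
obstruction-positive zero       B = z<s
obstruction-positive zero       C = z<s
obstruction-positive (suc zero) A = z<s
obstruction-positive (suc zero) B = z<s
obstruction-positive (suc zero) C = z<s

module ObstructionColoring (coloring : ℤ-Colorable obstruction) where

  color : ℕ → Fin 3
  color n = proj₁ coloring (+ n)

  apart : ∀ i j a → color a ≡ j → color (obstruction i j + a) ≡ j → ⊥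
  apart i j a ca cb = proj₂ coloring i j (+ (obstruction i j + a)) (+ a) (∣+[d+a]-+a∣≡d (obstruction i j) a) cb ca

  window : ∀ a → color a ≡ C ⊎ color (1 + a) ≡ C ⊎ color (2 + a) ≡ C
  window a with color a in c₀ | color (1 + a) in c₁ | color (2 + a) in c₂
  ... | C | _ | _ = inj₁ refl
  ... | _ | C | _ = inj₂ (inj₁ refl)
  ... | _ | _ | C = inj₂ (inj₂ refl)
  ... | A | A | _ = ⊥-elim (apart zero A a c₀ c₁)
  ... | B | B | _ = ⊥-elim (apart zero B a c₀ c₁)
  ... | _ | A | A = ⊥-elim (apart zero A (1 + a) c₁ c₂)
  ... | _ | B | B = ⊥-elim (apart zero B (1 + a) c₁ c₂)
  ... | A | B | A = ⊥-elim (apart (suc zero) A a c₀ c₂)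
  ... | B | A | B = ⊥-elim (apart (suc zero) B a c₀ c₂)

  C-successor : ∀ a → color a ≡ C → color (1 + a) ≡ C
  C-successor a ca with window (1 + a)
  ... | inj₁ c₁        = c₁
  ... | inj₂ (inj₁ c₂) = ⊥-elim (apart zero C a ca c₂)
  ... | inj₂ (inj₂ c₃) = ⊥-elim (apart (suc zero) C a ca c₃)

  C-empty : ∀ a → color a ≡ C → ⊥
  C-empty a ca = apart zero C a ca (C-successor (1 + a) (C-successor a ca))

  absurd : ⊥
  absurd with window 0
  ... | inj₁ c₀        = C-empty 0 c₀
  ... | inj₂ (inj₁ c₁) = C-empty 1 c₁
  ... | inj₂ (inj₂ c₂) = C-empty 2 c₂

¬obstruction-colorable : ¬ ℤ-Colorable obstruction
¬obstruction-colorable = ObstructionColoring.absurd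

¬ChiProperty-2-3 : ¬ ChiProperty 2 3
¬ChiProperty-2-3 χ = ¬obstruction-colorable (χ obstruction obstruction-positive)

theorem3 : (m : ℕ) → ChiProperty 2 m → 4 ≤ m
theorem3 m χ = ≮⇒≥ λ m<4 → ¬ChiProperty-2-3 (ChiProperty-mono (≤-pred m<4) χ)
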